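{- Let $d,\ell\geq1$ be integers and let $\mathcal{Q}=\{Q_{ij}\}_{1\leq i\leq d,\,1\leq j\leq\ell}$ be a collection of $\ell d$ polynomials in $\mathbb{Z}[r]$, with $k=\max_{i,j}\deg Q_{ij}\geq1$. There exists a constant $C_{\ell,d,k}=C_{\ell,d,k}(\mathcal{Q})$ such that if $N$ is sufficiently large (depending on $\mathcal{Q}$) and $A\subseteq[1,N]^d$ satisfies \[\frac{|A|}{N^d}\geq C_{\ell,d,k}\,N^{ -1/(\ell k)},\] then there exist $r',r''\in\mathbb{N}$ with $r'\neq r''$ such that for every $1\leq j\leq\ell$, \[\sum_{i=1}^d\bigl(Q_{ij}(r')-Q_{ij}(r'')\bigr)e_i\in A-A.\]
   Context: $e_1,\dots,e_d$ are the standard basis vectors of $\mathbb{Z}^d$; $[1,N]=\{1,\dots,N\}$ and $[1,N]^d$ its $d$-fold product; $A-A=\{a-a':a,a'\in A\}$. -}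

module Defs where

open import Data.Nat using (ℕ; zero; suc; _⊔_)
open import Data.Integer using (ℤ; +_; _+_; _*_; _-_; _≤_)
import Data.Integer as ℤ
open import Data.Bool using (Bool; true; false; if_then_else_)
open import Data.List using (List; []; _∷_)
open import Data.Bool using (_∧_)
open import Data.Fin using (Fin; zero; suc)
open import Data.Vec using (Vec; lookup)
open import Relation.Nullary.Decidable using (⌊_⌋)

-- A polynomial in ℤ[r], as its list of coefficients, constant term first:
-- a₀ ∷ a₁ ∷ … represents a₀ + a₁ r + a₂ r² + …
Poly : Set
Poly = List ℤ

eval : Poly → ℤ → ℤ
eval []       x = + 0
eval (a ∷ as) x = a + x * eval as x

isZeroPoly : Poly → Bool
isZeroPoly []       = true
isZeroPoly (a ∷ as) = ⌊ a ℤ.≟ + 0 ⌋ ∧ isZeroPoly as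

-- degree = index of the last nonzero coefficient (the zero polynomial gets degree 0)
deg : Poly → ℕ
deg []       = 0
deg (a ∷ as) = if isZeroPoly as then 0 else suc (deg as)

maxFin : (n : ℕ) → (Fin n → ℕ) → ℕ
maxFin zero    f = 0
maxFin (suc n) f = f zero ⊔ maxFin n (λ i → f (suc i))

maxDeg : (d ℓ : ℕ) → (Fin d → Fin ℓ → Poly) → ℕ
maxDeg d ℓ Q = maxFin d (λ i → maxFin ℓ (λ j → deg (Q i j)))

InBox : {d : ℕ} → ℕ → Vec ℤ d → Set
InBox {d} N x = (i : Fin d) → (+ 1 ≤ lookup x i) Data.Product.× (lookup x i ≤ + N)
  where import Data.Product

-- Let M = ⌊N^{1/k}⌋. For r < M and an ℓ-tuple t of elements of A, translate the j-th point
-- A[t j] by the vector (Q_ij(r))_i; after a further shift by B = N max ‖Q_ij‖₁ ≥ |Q_ij(r)| every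
-- translate lies in [0, N + 2B]^d. This gives M |A|^ℓ configurations in a set of ≈ N^{dℓ}
-- ℓ-tuples of points, and the density hypothesis makes the former number the larger. Two
-- configurations (r, t) ≠ (r′, t′) therefore coincide, i.e. A[t j] − A[t′ j] = Q_·j(r′) − Q_·j(r)
-- for all j; and r ≠ r′, since for r = r′ these equations force t = t′ because A has no repetitions.
module Submission where

open import Defs
open import Data.Bool using (true; false)
open import Data.Nat using (ℕ; zero; suc; _≤_; _<_; _*_; _+_; _^_; z≤n; s≤s; NonZero; >-nonZero)
open import Data.Nat.Properties
open import Data.Nat.Tactic.RingSolver using (solve-∀)
open import Data.Integer using (ℤ; _-_; +_; -[1+_]; ∣_∣)
import Data.Integer as ℤ
import Data.Integer.Properties as ℤ
import Data.Integer.Tactic.RingSolver as ℤ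
open import Data.Fin using (Fin; zero; suc; toℕ; fromℕ<; combine; quotient; remainder; finToFun; funToFin)
open import Data.Fin.Properties using (toℕ-fromℕ<; toℕ-injective; toℕ<n; combine-remQuot; finToFun-funToFin; funToFin-finToFin; pigeonhole)
import Data.Fin.Properties as Fin
open import Data.Vec using (Vec; lookup)
open import Data.Vec.Properties using (tabulate∘lookup; tabulate-cong)
open import Data.List as List using (List; []; _∷_; length)
open import Data.List.Relation.Unary.All as All using (All)
open import Data.List.Relation.Unary.AllPairs using (_∷_)
open import Data.List.Relation.Unary.Unique.Propositional using (Unique)
open import Data.List.Membership.Propositional using (_∈_)
open import Data.List.Membership.Propositional.Properties using (∈-lookup)
open import Data.Product using (Σ; ∃; _×_; _,_; proj₁; proj₂)
open import Data.Empty using (⊥)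
open import Function using (_∘_)
open import Relation.Nullary using (yes; no; contradiction)
open import Relation.Binary.PropositionalEquality

‖_‖₁ : Poly → ℕ
‖ [] ‖₁     = 0
‖ a ∷ as ‖₁ = ∣ a ∣ + ‖ as ‖₁

eval-isZeroPoly : ∀ p → isZeroPoly p ≡ true → ∀ x → eval p x ≡ + 0
eval-isZeroPoly [] _ x = refl
eval-isZeroPoly (a ∷ as) p≡0 x with a ℤ.≟ + 0
... | yes refl rewrite eval-isZeroPoly as p≡0 x | ℤ.*-zeroʳ x = refl

∣eval∣≤‖p‖₁*M^deg : ∀ p {r M} → r ≤ M → 1 ≤ M → ∣ eval p (+ r) ∣ ≤ ‖ p ‖₁ * M ^ deg p
∣eval∣≤‖p‖₁*M^deg [] r≤M 1≤M = z≤n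
∣eval∣≤‖p‖₁*M^deg (a ∷ as) {r} {M} r≤M 1≤M with isZeroPoly as in as≡0
... | true rewrite eval-isZeroPoly as as≡0 (+ r) | ℤ.*-zeroʳ (+ r) | ℤ.+-identityʳ a
                 | *-identityʳ (∣ a ∣ + ‖ as ‖₁) = m≤m+n ∣ a ∣ ‖ as ‖₁
... | false = begin
  ∣ a ℤ.+ + r ℤ.* eval as (+ r) ∣                      ≤⟨ ℤ.∣i+j∣≤∣i∣+∣j∣ a _ ⟩
  ∣ a ∣ + ∣ + r ℤ.* eval as (+ r) ∣                     ≡⟨ cong (λ x → ∣ a ∣ + x) (ℤ.∣i*j∣≡∣i∣*∣j∣ (+ r) _) ⟩
  ∣ a ∣ + r * ∣ eval as (+ r) ∣                         ≤⟨ +-mono-≤ (m≤m*n ∣ a ∣ (M * M ^ deg as) {{M^≢0}})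
                                                           (*-mono-≤ r≤M (∣eval∣≤‖p‖₁*M^deg as r≤M 1≤M)) ⟩
  ∣ a ∣ * (M * M ^ deg as) + M * (‖ as ‖₁ * M ^ deg as) ≡⟨ regroup ∣ a ∣ M (M ^ deg as) ‖ as ‖₁ ⟩
  (∣ a ∣ + ‖ as ‖₁) * (M * M ^ deg as)                  ∎
  where
  open ≤-Reasoning
  M^≢0 = m^n≢0 M (suc (deg as)) {{>-nonZero 1≤M}}
  regroup : ∀ x y z w → x * (y * z) + y * (w * z) ≡ (x + w) * (y * z)
  regroup = solve-∀

maxNorm₁ : ∀ {d ℓ} → (Fin d → Fin ℓ → Poly) → ℕ
maxNorm₁ {d} {ℓ} Q = maxFin d (λ i → maxFin ℓ (λ j → ‖ Q i j ‖₁))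

≤-maxFin : ∀ n (f : Fin n → ℕ) i → f i ≤ maxFin n f
≤-maxFin (suc n) f zero    = m≤m⊔n _ _
≤-maxFin (suc n) f (suc i) = ≤-trans (≤-maxFin n (λ i → f (suc i)) i) (m≤n⊔m (f zero) _)

≤-maxFin² : ∀ m n (g : Fin m → Fin n → ℕ) i j → g i j ≤ maxFin m (λ i → maxFin n (g i))
≤-maxFin² m n g i j = ≤-trans (≤-maxFin n (g i) j) (≤-maxFin m (λ i → maxFin n (g i)) i)

⌊root⌋ : ∀ k .{{_ : NonZero k}} n → ∃ λ M → 1 ≤ M × M ^ k ≤ suc n × suc n < suc M ^ k
⌊root⌋ k zero = 1 , ≤-refl , ≤-reflexive (^-zeroˡ k) , subst (_< 2 ^ k) (^-zeroˡ k) (^-monoˡ-< k (n<1+n 1))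
⌊root⌋ k (suc n) with ⌊root⌋ k n
... | M , 1≤M , M^k≤ , <sM^k with suc (suc n) <? suc M ^ k
...   | yes <sM^k′ = M , 1≤M , m≤n⇒m≤1+n M^k≤ , <sM^k′
...   | no ≮sM^k   = suc M , s≤s z≤n , ≤-reflexive sM^k≡ , subst (_< suc (suc M) ^ k) sM^k≡ (^-monoˡ-< k (n<1+n (suc M)))
  where
  sM^k≡ : suc M ^ k ≡ suc (suc n)
  sM^k≡ = ≤-antisym (≮⇒≥ ≮sM^k) <sM^k

^-distribʳ-* : ∀ m n o → (m * n) ^ o ≡ m ^ o * n ^ o
^-distribʳ-* m n zero    = refl
^-distribʳ-* m n (suc o) rewrite ^-distribʳ-* m n o = interchange m n (m ^ o) (n ^ o)
  where
  interchange : ∀ a b x y → a * b * (x * y) ≡ a * x * (b * y)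
  interchange = solve-∀

^-cancelʳ-< : ∀ {m n} k → m ^ k < n ^ k → m < n
^-cancelʳ-< {m} {n} k m^k<n^k = ≰⇒> λ n≤m → <⇒≱ m^k<n^k (^-monoˡ-≤ k n≤m)

-- Compare k-th powers: the factor 2 in C = 2 K^d pays for N < (M + 1)^k ≤ (2 M)^k.
density⇒S^dℓ<M*L^ℓ : ∀ {d ℓ k K N M L S} → 1 ≤ ℓ → 1 ≤ S → 1 ≤ M → N < suc M ^ k → S ≤ K * N →
  (2 * K ^ d) ^ (ℓ * k) * N ^ (d * (ℓ * k)) ≤ L ^ (ℓ * k) * N →
  (S ^ d) ^ ℓ < M * L ^ ℓ
density⇒S^dℓ<M*L^ℓ {d} {ℓ} {k} {K} {N} {M} {L} {S} 1≤ℓ 1≤S 1≤M N<sM^k S≤KN density =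
  ≤-<-trans (^-monoˡ-≤ ℓ (^-monoˡ-≤ d S≤KN)) (*-cancelˡ-< 2 _ _ (^-cancelʳ-< k 2X^k<2Y^k))
  where
  X = ((K * N) ^ d) ^ ℓ
  Y = M * L ^ ℓ
  m = ℓ * k
  X≢0 : NonZero X
  X≢0 = m^n≢0 ((K * N) ^ d) ℓ {{m^n≢0 (K * N) d {{>-nonZero (≤-trans 1≤S S≤KN)}}}}
  lhs≡ : (2 * K ^ d) ^ m * N ^ (d * m) ≡ 2 ^ m * X ^ k
  lhs≡ = begin
    (2 * K ^ d) ^ m * N ^ (d * m)         ≡⟨ cong (_* N ^ (d * m)) (^-distribʳ-* 2 (K ^ d) m) ⟩
    2 ^ m * (K ^ d) ^ m * N ^ (d * m)     ≡⟨ cong (λ x → 2 ^ m * x * N ^ (d * m)) (^-*-assoc K d m) ⟩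
    2 ^ m * K ^ (d * m) * N ^ (d * m)     ≡⟨ *-assoc (2 ^ m) _ _ ⟩
    2 ^ m * (K ^ (d * m) * N ^ (d * m))   ≡⟨ cong (2 ^ m *_) (sym (^-distribʳ-* K N (d * m))) ⟩
    2 ^ m * (K * N) ^ (d * m)             ≡⟨ cong (λ e → 2 ^ m * (K * N) ^ e) (sym (*-assoc d ℓ k)) ⟩
    2 ^ m * (K * N) ^ (d * ℓ * k)         ≡⟨ cong (2 ^ m *_) (sym (^-*-assoc (K * N) (d * ℓ) k)) ⟩
    2 ^ m * ((K * N) ^ (d * ℓ)) ^ k       ≡⟨ cong (λ x → 2 ^ m * x ^ k) (sym (^-*-assoc (K * N) d ℓ)) ⟩
    2 ^ m * X ^ k                         ∎
    where open ≡-Reasoning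
  rhs≡ : L ^ m * (2 * M) ^ k ≡ (2 * Y) ^ k
  rhs≡ = begin
    L ^ m * (2 * M) ^ k       ≡⟨ cong (_* (2 * M) ^ k) (sym (^-*-assoc L ℓ k)) ⟩
    (L ^ ℓ) ^ k * (2 * M) ^ k ≡⟨ sym (^-distribʳ-* (L ^ ℓ) (2 * M) k) ⟩
    (L ^ ℓ * (2 * M)) ^ k     ≡⟨ cong (_^ k) (regroup (L ^ ℓ) M) ⟩
    (2 * Y) ^ k               ∎
    where
    open ≡-Reasoning
    regroup : ∀ a b → a * (2 * b) ≡ 2 * (b * a)
    regroup = solve-∀
  L^m≢0 : NonZero (L ^ m)
  L^m≢0 = m*n≢0⇒m≢0 (L ^ m) {{>-nonZero (≤-trans (*-mono-≤ (m^n>0 2 m) (m^n>0 X {{X≢0}} k))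
                                                 (≤-trans (≤-reflexive (sym lhs≡)) density))}}
  2X^k<2Y^k : (2 * X) ^ k < (2 * Y) ^ k
  2X^k<2Y^k = begin-strict
    (2 * X) ^ k                       ≡⟨ ^-distribʳ-* 2 X k ⟩
    2 ^ k * X ^ k                     ≤⟨ *-monoˡ-≤ (X ^ k) (^-monoʳ-≤ 2 (m≤n*m k ℓ {{>-nonZero 1≤ℓ}})) ⟩
    2 ^ m * X ^ k                     ≡⟨ sym lhs≡ ⟩
    (2 * K ^ d) ^ m * N ^ (d * m)     ≤⟨ density ⟩
    L ^ m * N                         <⟨ *-monoʳ-< (L ^ m) {{L^m≢0}} N<sM^k ⟩
    L ^ m * suc M ^ k                 ≤⟨ *-monoʳ-≤ (L ^ m) (^-monoˡ-≤ k sM≤2M) ⟩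
    L ^ m * (2 * M) ^ k               ≡⟨ rhs≡ ⟩
    (2 * Y) ^ k                       ∎
    where
    open ≤-Reasoning
    sM≤2M : suc M ≤ 2 * M
    sM≤2M = ≤-trans (+-monoˡ-≤ M 1≤M) (≤-reflexive (cong (λ x → M + x) (sym (+-identityʳ M))))

funToFin-cong : ∀ {m n} {f g : Fin m → Fin n} → f ≗ g → funToFin f ≡ funToFin g
funToFin-cong {zero}  f≗g = refl
funToFin-cong {suc m} f≗g = cong₂ combine (f≗g zero) (funToFin-cong (f≗g ∘ suc))

funToFin-injective : ∀ {m n} {f g : Fin m → Fin n} → funToFin f ≡ funToFin g → f ≗ g
funToFin-injective {f = f} {g} eq i = begin
  f i                     ≡⟨ finToFun-funToFin f i ⟨
  finToFun (funToFin f) i ≡⟨ cong (λ x → finToFun x i) eq ⟩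
  finToFun (funToFin g) i ≡⟨ finToFun-funToFin g i ⟩
  g i                     ∎
  where open ≡-Reasoning

finToFun-injective : ∀ {m n} {x y : Fin (m ^ n)} → finToFun {m} {n} x ≗ finToFun y → x ≡ y
finToFun-injective {m} {n} {x} {y} eq = begin
  x                                 ≡⟨ funToFin-finToFin {n} {m} x ⟨
  funToFin (finToFun {m} {n} x)     ≡⟨ funToFin-cong eq ⟩
  funToFin (finToFun {m} {n} y)     ≡⟨ funToFin-finToFin {n} {m} y ⟩
  y                                 ∎
  where open ≡-Reasoning

pigeonhole-tuples : ∀ {M L T} ℓ → T < M * L ^ ℓ → (f : Fin M → (Fin ℓ → Fin L) → Fin T) →
  Σ (Fin M) λ r → Σ (Fin ℓ → Fin L) λ t → Σ (Fin M) λ r′ → Σ (Fin ℓ → Fin L) λ t′ →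
    f r t ≡ f r′ t′ × (r ≡ r′ → t ≗ t′ → ⊥)
pigeonhole-tuples {M} {L} ℓ T<ML^ℓ f
  with pigeonhole T<ML^ℓ (λ x → f (quotient (L ^ ℓ) x) (finToFun (remainder {M} (L ^ ℓ) x)))
... | x , y , x<y , fx≡fy = row x , finToFun (column x) , row y , finToFun (column y) , fx≡fy , distinct
  where
  row : Fin (M * L ^ ℓ) → Fin M
  row = quotient (L ^ ℓ)
  column : Fin (M * L ^ ℓ) → Fin (L ^ ℓ)
  column = remainder {M} (L ^ ℓ)
  distinct : row x ≡ row y → finToFun (column x) ≗ finToFun (column y) → ⊥
  distinct rx≡ry tx≗ty = Fin.<⇒≢ x<y (begin
    x                             ≡⟨ combine-remQuot {M} (L ^ ℓ) x ⟨
    combine (row x) (column x)    ≡⟨ cong₂ combine rx≡ry (finToFun-injective tx≗ty) ⟩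
    combine (row y) (column y)    ≡⟨ combine-remQuot {M} (L ^ ℓ) y ⟩
    y                             ∎)
    where open ≡-Reasoning

Unique⇒lookup-injective : ∀ {A : Set} (xs : List A) → Unique xs →
  ∀ i j → List.lookup xs i ≡ List.lookup xs j → i ≡ j
Unique⇒lookup-injective (x ∷ xs) (x∉xs ∷ xs!) zero    zero    _  = refl
Unique⇒lookup-injective (x ∷ xs) (x∉xs ∷ xs!) zero    (suc j) eq = contradiction eq (All.lookup x∉xs (∈-lookup j))
Unique⇒lookup-injective (x ∷ xs) (x∉xs ∷ xs!) (suc i) zero    eq = contradiction (sym eq) (All.lookup x∉xs (∈-lookup i))
Unique⇒lookup-injective (x ∷ xs) (x∉xs ∷ xs!) (suc i) (suc j) eq = cong suc (Unique⇒lookup-injective xs xs! i j eq)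

lookup-≗⇒≡ : ∀ {A : Set} {n} {u v : Vec A n} → lookup u ≗ lookup v → u ≡ v
lookup-≗⇒≡ {u = u} {v} eq = trans (sym (tabulate∘lookup u)) (trans (tabulate-cong eq) (tabulate∘lookup v))

shifted-range : ∀ {N B} {a e : ℤ} → + 1 ℤ.≤ a → a ℤ.≤ + N → ∣ e ∣ ≤ B →
  + 0 ℤ.≤ a ℤ.+ (e ℤ.+ + B) × ∣ a ℤ.+ (e ℤ.+ + B) ∣ < suc (N + (B + B))
shifted-range {N} {B} {a} {e} 1≤a a≤N ∣e∣≤B =
  ℤ.+-mono-≤ (ℤ.≤-trans (ℤ.+≤+ z≤n) 1≤a) (0≤e+B e ∣e∣≤B) ,
  s≤s (≤-trans (ℤ.∣i+j∣≤∣i∣+∣j∣ a _)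
        (+-mono-≤ (∣a∣≤N a 1≤a a≤N) (≤-trans (ℤ.∣i+j∣≤∣i∣+∣j∣ e (+ B)) (+-monoˡ-≤ B ∣e∣≤B))))
  where
  0≤e+B : ∀ e → ∣ e ∣ ≤ B → + 0 ℤ.≤ e ℤ.+ + B
  0≤e+B (+ n)      _     = ℤ.+≤+ z≤n
  0≤e+B -[1+ n ] ∣e∣≤B rewrite ℤ.⊖-≥ ∣e∣≤B = ℤ.+≤+ z≤n
  ∣a∣≤N : ∀ a → + 1 ℤ.≤ a → a ℤ.≤ + N → ∣ a ∣ ≤ N
  ∣a∣≤N (+ n) _ (ℤ.+≤+ n≤N) = n≤N

fromℕ<-∣∣-injective : ∀ {S} {z z′ : ℤ} (p : ∣ z ∣ < S) (p′ : ∣ z′ ∣ < S) →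
  + 0 ℤ.≤ z → + 0 ℤ.≤ z′ → fromℕ< p ≡ fromℕ< p′ → z ≡ z′
fromℕ<-∣∣-injective p p′ (ℤ.+≤+ _) (ℤ.+≤+ _) eq =
  cong +_ (trans (sym (toℕ-fromℕ< p)) (trans (cong toℕ eq) (toℕ-fromℕ< p′)))

shifts-differ : ∀ (a a′ e e′ B : ℤ) → a ℤ.+ (e ℤ.+ B) ≡ a′ ℤ.+ (e′ ℤ.+ B) → a - a′ ≡ e′ - e
shifts-differ a a′ e e′ B eq = begin
  a - a′                                              ≡⟨ regroup a a′ e e′ B ⟩
  (a ℤ.+ (e ℤ.+ B)) - (a′ ℤ.+ (e′ ℤ.+ B)) ℤ.+ (e′ - e) ≡⟨ cong (λ x → x - (a′ ℤ.+ (e′ ℤ.+ B)) ℤ.+ (e′ - e)) eq ⟩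
  (a′ ℤ.+ (e′ ℤ.+ B)) - (a′ ℤ.+ (e′ ℤ.+ B)) ℤ.+ (e′ - e) ≡⟨ cong (ℤ._+ (e′ - e)) (ℤ.+-inverseʳ (a′ ℤ.+ (e′ ℤ.+ B))) ⟩
  + 0 ℤ.+ (e′ - e)                                    ≡⟨ ℤ.+-identityˡ (e′ - e) ⟩
  e′ - e                                              ∎
  where
  open ≡-Reasoning
  regroup : ∀ (a a′ e e′ B : ℤ) → a - a′ ≡ (a ℤ.+ (e ℤ.+ B)) - (a′ ℤ.+ (e′ ℤ.+ B)) ℤ.+ (e′ - e)
  regroup = ℤ.solve-∀

HasPolynomialDifferences : ∀ {d ℓ} → (Fin d → Fin ℓ → Poly) → List (Vec ℤ d) → Set
HasPolynomialDifferences {d} {ℓ} Q A = Σ ℕ λ r′ → Σ ℕ λ r″ → r′ ≢ r″ ×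
  ((j : Fin ℓ) → Σ (Vec ℤ d) λ a → Σ (Vec ℤ d) λ a′ → a ∈ A × a′ ∈ A ×
    ((i : Fin d) → lookup a i - lookup a′ i ≡ eval (Q i j) (+ r′) - eval (Q i j) (+ r″)))

module _ {d ℓ k N M : ℕ} (Q : Fin d → Fin ℓ → Poly) (deg≤k : ∀ i j → deg (Q i j) ≤ k)
         (1≤M : 1 ≤ M) (M^k≤N : M ^ k ≤ N)
         (A : List (Vec ℤ d)) (A-unique : Unique A) (A⊆box : All (InBox N) A) where

  B : ℕ
  B = maxNorm₁ Q * N

  ∣Q∣≤B : ∀ {r} → r ≤ M → ∀ i j → ∣ eval (Q i j) (+ r) ∣ ≤ B
  ∣Q∣≤B r≤M i j = ≤-trans (∣eval∣≤‖p‖₁*M^deg (Q i j) r≤M 1≤M)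
    (*-mono-≤ (≤-maxFin² d ℓ (λ i j → ‖ Q i j ‖₁) i j)
              (≤-trans (^-monoʳ-≤ M {{>-nonZero 1≤M}} (deg≤k i j)) M^k≤N))

  point : Fin M → (Fin ℓ → Fin (length A)) → Fin ℓ → Fin d → ℤ
  point r t j i = lookup (List.lookup A (t j)) i ℤ.+ (eval (Q i j) (+ toℕ r) ℤ.+ + B)

  point-range : ∀ r t j i → + 0 ℤ.≤ point r t j i × ∣ point r t j i ∣ < suc (N + (B + B))
  point-range r t j i =
    shifted-range {e = eval (Q i j) (+ toℕ r)} (proj₁ (box i)) (proj₂ (box i)) (∣Q∣≤B (<⇒≤ (toℕ<n r)) i j)
    where
    box : InBox N (List.lookup A (t j))
    box = All.lookup A⊆box (∈-lookup (t j))

  code : Fin M → (Fin ℓ → Fin (length A)) → Fin ((suc (N + (B + B)) ^ d) ^ ℓ)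
  code r t = funToFin λ j → funToFin λ i → fromℕ< (proj₂ (point-range r t j i))

  code-injective : ∀ {r t r′ t′} → code r t ≡ code r′ t′ → ∀ j i → point r t j i ≡ point r′ t′ j i
  code-injective {r} {t} {r′} {t′} eq j i =
    fromℕ<-∣∣-injective (proj₂ (point-range r t j i)) (proj₂ (point-range r′ t′ j i))
                        (proj₁ (point-range r t j i)) (proj₁ (point-range r′ t′ j i))
      (funToFin-injective (funToFin-injective eq j) i)

  point-difference : ∀ {r t r′ t′} → (∀ j i → point r t j i ≡ point r′ t′ j i) → ∀ j i →
    lookup (List.lookup A (t j)) i - lookup (List.lookup A (t′ j)) i ≡ eval (Q i j) (+ toℕ r′) - eval (Q i j) (+ toℕ r)
  point-difference {r} {t} {r′} {t′} same j i =
    shifts-differ (lookup (List.lookup A (t j)) i) (lookup (List.lookup A (t′ j)) i)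
                  (eval (Q i j) (+ toℕ r)) (eval (Q i j) (+ toℕ r′)) (+ B) (same j i)

  tuple-determined : ∀ {r r′ t t′} → (∀ j i → point r t j i ≡ point r′ t′ j i) → r ≡ r′ → t ≗ t′
  tuple-determined {r} {t = t} {t′} same refl j =
    Unique⇒lookup-injective A A-unique (t j) (t′ j) (lookup-≗⇒≡ λ i →
      ℤ.i-j≡0⇒i≡j _ _ (trans (point-difference same j i) (ℤ.+-inverseʳ (eval (Q i j) (+ toℕ r)))))

  polynomial-differences : (suc (N + (B + B)) ^ d) ^ ℓ < M * length A ^ ℓ → HasPolynomialDifferences Q A
  polynomial-differences count with pigeonhole-tuples ℓ count code
  ... | r , t , r′ , t′ , same-code , distinct =
    toℕ r′ , toℕ r , r′≢r ,
    λ j → List.lookup A (t j) , List.lookup A (t′ j) , ∈-lookup (t j) , ∈-lookup (t′ j) ,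
          point-difference same-point j
    where
    same-point : ∀ j i → point r t j i ≡ point r′ t′ j i
    same-point = code-injective same-code
    r′≢r : toℕ r′ ≢ toℕ r
    r′≢r r′≡r = distinct r≡r′ (tuple-determined same-point r≡r′)
      where
      r≡r′ = toℕ-injective (sym r′≡r)

1+N+2HN≤[2+2H]N : ∀ H N → 1 ≤ N → suc (N + (H * N + H * N)) ≤ (2 + (H + H)) * N
1+N+2HN≤[2+2H]N H N 1≤N = ≤-trans (+-monoˡ-≤ (H * N + H * N) (+-monoˡ-≤ N 1≤N)) (≤-reflexive (distrib H N))
  where
  distrib : ∀ H N → N + N + (H * N + H * N) ≡ (2 + (H + H)) * N
  distrib = solve-∀

theorem3p3 : (d ℓ : ℕ) → 1 ≤ d → 1 ≤ ℓ → (Q : Fin d → Fin ℓ → Poly) →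
    1 ≤ maxDeg d ℓ Q →
    Σ ℕ λ C → Σ ℕ λ N₀ → (N : ℕ) → N₀ ≤ N →
      (A : List (Vec ℤ d)) → Unique A → All (InBox N) A →
      (C ^ (ℓ * maxDeg d ℓ Q)) * (N ^ (d * (ℓ * maxDeg d ℓ Q))) ≤ (length A ^ (ℓ * maxDeg d ℓ Q)) * N →
      Σ ℕ λ r′ → Σ ℕ λ r″ → r′ ≢ r″ ×
        ((j : Fin ℓ) → Σ (Vec ℤ d) λ a → Σ (Vec ℤ d) λ a′ → a ∈ A × a′ ∈ A ×
          ((i : Fin d) → lookup a i - lookup a′ i ≡ eval (Q i j) (+ r′) - eval (Q i j) (+ r″)))
theorem3p3 d ℓ _ 1≤ℓ Q 1≤k = 2 * K ^ d , 1 , differences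
  where
  k = maxDeg d ℓ Q
  H = maxNorm₁ Q
  K = 2 + (H + H)
  differences : (N : ℕ) → 1 ≤ N → (A : List (Vec ℤ d)) → Unique A → All (InBox N) A →
    (2 * K ^ d) ^ (ℓ * k) * N ^ (d * (ℓ * k)) ≤ length A ^ (ℓ * k) * N → HasPolynomialDifferences Q A
  differences (suc n) 1≤N A A-unique A⊆box density with ⌊root⌋ k {{>-nonZero 1≤k}} n
  ... | M , 1≤M , M^k≤N , N<sM^k =
    polynomial-differences Q (≤-maxFin² d ℓ (λ i j → deg (Q i j))) 1≤M M^k≤N A A-unique A⊆box
      (density⇒S^dℓ<M*L^ℓ {d = d} {K = K} 1≤ℓ (s≤s z≤n) 1≤M N<sM^k (1+N+2HN≤[2+2H]N H (suc n) 1≤N) density)
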